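{- Let $G$ be a graph with a $k$-correspondence assignment $C$. Let $H$ be a subgraph of $G$ such that for every cycle $K$ in $H$, the assignment $C$ is consistent on $K$ and all edges of $K$ are full. Then there exists a $k$-correspondence assignment $C'$ for $G$ equivalent to $C$ such that all edges of $H$ are straight in $C'$, and all vertices not belonging to $H$ are fixed.
   Context: All graphs are finite and simple; $[k]=\{1,\dots,k\}$. Fix an orientation $\vec G$ of $G$. A $k$-correspondence assignment for $G$ is a function $C$ assigning to every edge $e\in E(\vec G)$ an injective, not necessarily total, function $C_e:[k]\to[k]$. For $uv\in E(\vec G)$ set $C_{vu}=C_{uv}^{ -1}$. For injective partial functions $A,B$ on $[k]$, $A\circ B$ is the partial function with domain $\{c\in\mathrm{dom}(A):A(c)\in\mathrm{dom}(B)\}$ and $(A\circ B)(c)=B(A(c))$. For a walk $W=v_1\dots v_m$, $C_W=C_{v_1v_2}\circ\dots\circ C_{v_{m-1}v_m}$; $C$ is consistent on a closed walk $W$ ($v_1=v_m$) if $C_W(c)=c$ for all $c\in\mathrm{dom}(C_W)$; "consistent on a cycle $K$" means consistent on the closed walk traversing $K$. An edge $uv$ is straight in $C$ if $C_{uv}(c)=c$ for every $c\in\mathrm{dom}(C_{uv})$, and full if $\mathrm{dom}(C_{uv})=[k]$. Two assignments $C,C'$ are equivalent if there exist permutations $\pi_v$ of $[k]$, $v\in V(G)$, with $C_{uv}=\pi_u\circ C'_{uv}\circ\pi_v^{ -1}$ for every edge $uv$; a vertex $v$ is fixed if $\pi_v$ is the identity. -}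

module Defs where

open import Data.Nat using (ℕ; _≤_)
open import Data.Bool using (Bool; true; false)
open import Data.Fin using (Fin)
open import Data.Fin.Permutation using (Permutation′; _⟨$⟩ʳ_; _⟨$⟩ˡ_)
open import Data.Maybe using (Maybe; just)
import Data.Maybe as Maybe
open import Data.List using (List; []; _∷_; _++_; [_]; length)
open import Data.List.Relation.Unary.Unique.Propositional using (Unique)
open import Data.Product using (Σ; ∃; _×_; _,_)
open import Data.Sum using (_⊎_)
open import Data.Empty using (⊥)
open import Data.Unit using (⊤)
open import Relation.Binary.PropositionalEquality using (_≡_)

-- An oriented finite simple graph on vertex set Fin n:
-- arc u v = true means uv is an edge oriented from u to v.
record OrientedGraph (n : ℕ) : Set where
  field
    arc     : Fin n → Fin n → Bool
    irrefl  : ∀ v → arc v v ≡ false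
    antisym : ∀ u v → arc u v ≡ true → arc v u ≡ false
open OrientedGraph public

PartialFn : ℕ → Set
PartialFn k = Fin k → Maybe (Fin k)

InjectivePartial : ∀ {k} → PartialFn k → Set
InjectivePartial {k} f = ∀ (a b c : Fin k) → f a ≡ just c → f b ≡ just c → a ≡ b

-- A k-correspondence assignment: C u v is C_{uv} for each oriented edge uv
-- (values on non-edges are irrelevant).
Assignment : ℕ → ℕ → Set
Assignment n k = Fin n → Fin n → PartialFn k

IsCorrespondenceAssignment : ∀ {n} (G : OrientedGraph n) (k : ℕ) → Assignment n k → Set
IsCorrespondenceAssignment {n} G k C =
  ∀ (u v : Fin n) → arc G u v ≡ true → InjectivePartial (C u v)

-- Graph of C_{uv} traversed from u to v, for u,v adjacent in G
-- (uses C_{vu} = C_{uv}^{-1} when the edge is oriented v → u).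
Step : ∀ {n k} (G : OrientedGraph n) → Assignment n k → Fin n → Fin n → Fin k → Fin k → Set
Step G C u v c d = (arc G u v ≡ true × C u v c ≡ just d) ⊎ (arc G v u ≡ true × C v u d ≡ just c)

-- Graph of C_W for a walk W given as its vertex list (composition left to right).
WalkRel : ∀ {n k} (G : OrientedGraph n) → Assignment n k → List (Fin n) → Fin k → Fin k → Set
WalkRel G C [] c d = ⊥
WalkRel G C (v ∷ []) c d = c ≡ d
WalkRel G C (u ∷ v ∷ W) c e = ∃ λ d → Step G C u v c d × WalkRel G C (v ∷ W) d e

ConsistentOn : ∀ {n k} (G : OrientedGraph n) → Assignment n k → List (Fin n) → Set
ConsistentOn {n} {k} G C W = ∀ (c d : Fin k) → WalkRel G C W c d → c ≡ d

closedWalk : ∀ {n} → List (Fin n) → List (Fin n)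
closedWalk [] = []
closedWalk (v ∷ vs) = v ∷ vs ++ [ v ]

Consecutive : ∀ {n} → (Fin n → Fin n → Set) → List (Fin n) → Set
Consecutive P [] = ⊤
Consecutive P (v ∷ []) = ⊤
Consecutive P (u ∷ v ∷ W) = P u v × Consecutive P (v ∷ W)

FullArc : ∀ {n k} → Assignment n k → Fin n → Fin n → Set
FullArc {n} {k} C u v = ∀ (c : Fin k) → ∃ λ d → C u v c ≡ just d

StraightArc : ∀ {n k} → Assignment n k → Fin n → Fin n → Set
StraightArc {n} {k} C u v = ∀ (c d : Fin k) → C u v c ≡ just d → c ≡ d

FullEdge : ∀ {n k} (G : OrientedGraph n) → Assignment n k → Fin n → Fin n → Set
FullEdge G C x y = (arc G x y ≡ true → FullArc C x y) × (arc G y x ≡ true → FullArc C y x)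

record Subgraph {n} (G : OrientedGraph n) : Set where
  field
    inV   : Fin n → Bool
    inE   : Fin n → Fin n → Bool
    inE⊆  : ∀ u v → inE u v ≡ true → arc G u v ≡ true × inV u ≡ true × inV v ≡ true
open Subgraph public

AdjIn : ∀ {n} {G : OrientedGraph n} → Subgraph G → Fin n → Fin n → Set
AdjIn H x y = inE H x y ≡ true ⊎ inE H y x ≡ true

IsCycleIn : ∀ {n} {G : OrientedGraph n} → Subgraph G → List (Fin n) → Set
IsCycleIn H K = 3 ≤ length K × Unique K × Consecutive (AdjIn H) (closedWalk K)

-- C and C' are equivalent via permutations π:
-- C_{uv} = π_u ∘ C'_{uv} ∘ π_v⁻¹ (left-to-right composition), i.e.
-- C_{uv}(c) = π_v⁻¹(C'_{uv}(π_u(c))) for every edge uv.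
EquivalentVia : ∀ {n k} (G : OrientedGraph n) → Assignment n k → Assignment n k
              → (Fin n → Permutation′ k) → Set
EquivalentVia {n} {k} G C C' π =
  ∀ (u v : Fin n) → arc G u v ≡ true →
    ∀ (c : Fin k) → C u v c ≡ Maybe.map (π v ⟨$⟩ˡ_) (C' u v (π u ⟨$⟩ʳ c))

Fixed : ∀ {n k} → (Fin n → Permutation′ k) → Fin n → Set
Fixed {n} {k} π v = ∀ (c : Fin k) → π v ⟨$⟩ʳ c ≡ c

module Submission where

-- It suffices to find permutations π_v of [k] that ALIGN every edge uv of H, i.e.
-- π_u(c) = π_v(C_uv(c)) whenever C_uv(c) is defined, and that are the identity
-- outside H: the conjugated assignment C'_uv = π_u⁻¹ ; C_uv ; π_v is then
-- equivalent to C via π, injective, and straight on every edge of H.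
--
-- The permutations are built by a union-find style scan of all pairs (u,v),
-- maintaining a labelling of the components of the H-edges processed so far
-- (any two vertices with the same label are joined by a SIMPLE path of processed
-- edges) and permutations aligning every processed edge.  A new H-edge xy either
--   * joins two vertices of one component: the simple path y ⋯ x closed by xy is a
--     cycle of H, and transporting colours along the aligned, full path shows by
--     consistency that xy is already aligned; or
--   * merges two components: post-composing all permutations of y's component
--     with a permutation σ extending the partial injection π_x⁻¹ ; C_xy ; π_y
--     aligns xy and keeps the old edges aligned.
-- Vertices outside H are isolated, so their permutations are never changed.

open import Defs
open import Data.Nat using (ℕ; s≤s; z≤n)
open import Data.Bool using (true; false)
open import Data.Fin using (Fin; _≟_)
open import Data.Fin.Permutation
  using (Permutation′; _⟨$⟩ʳ_; _⟨$⟩ˡ_; inverseˡ; inverseʳ; _∘ₚ_; transpose; flip)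
  renaming (id to idₚ)
import Data.Fin.Permutation.Components as Transposition
open import Data.Maybe using (just; nothing)
import Data.Maybe as Maybe
open import Data.Maybe.Properties using (just-injective)
open import Data.List using (List; []; _∷_; _++_; [_]; allFin; cartesianProduct)
open import Data.List.Membership.Propositional using (_∈_)
open import Data.List.Membership.Propositional.Properties using (∈-allFin; ∈-cartesianProduct⁺)
open import Data.List.Relation.Unary.Any using (here; there)
open import Data.List.Relation.Unary.Unique.Propositional using (Unique)
open import Data.List.Relation.Unary.All using ([])
open import Data.List.Relation.Unary.AllPairs using ([]; _∷_)
import Data.List.Relation.Unary.Unique.Propositional.Properties as Unique
import Data.List.Relation.Binary.Permutation.Setoid.Properties as ↭
open import Data.Product using (Σ; ∃; _×_; _,_; proj₁; proj₂)
open import Data.Sum using (_⊎_; inj₁; inj₂)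
import Data.Sum as Sum
open import Data.Empty using (⊥-elim)
open import Data.Unit using (tt)
open import Function.Bundles using (Injection)
open import Function.Properties.Inverse using (↔⇒↣)
open import Relation.Nullary using (Dec; yes; no)
open import Relation.Binary.PropositionalEquality hiding ([_])

true≢false : true ≢ false
true≢false ()

-- Partial injections and permutations of [k]

module _ {k : ℕ} where

  perm-injective : (π : Permutation′ k) {a b : Fin k} → π ⟨$⟩ʳ a ≡ π ⟨$⟩ʳ b → a ≡ b
  perm-injective π = Injection.injective (↔⇒↣ π)

  transpose-source : (i j : Fin k) → Transposition.transpose i j i ≡ j
  transpose-source i j with i ≟ i
  ... | yes _ = refl
  ... | no i≢i = ⊥-elim (i≢i refl)

  transpose-other : (i j x : Fin k) → x ≢ i → x ≢ j → Transposition.transpose i j x ≡ x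
  transpose-other i j x x≢i x≢j with x ≟ i
  ... | yes x≡i = ⊥-elim (x≢i x≡i)
  ... | no _ with x ≟ j
  ...   | yes x≡j = ⊥-elim (x≢j x≡j)
  ...   | no _ = refl

  -- An injective partial function agrees on any list D of arguments with some
  -- permutation: treat the arguments one by one, fixing the value of each new
  -- argument c by a transposition, which cannot disturb the earlier arguments.
  extendOn : (f : PartialFn k) → InjectivePartial f → (D : List (Fin k)) →
             Σ (Permutation′ k) λ τ → ∀ a b → a ∈ D → f a ≡ just b → τ ⟨$⟩ʳ a ≡ b
  extendOn f inj [] = idₚ , λ _ _ ()
  extendOn f inj (c ∷ D) with extendOn f inj D | f c in fc
  ... | τ , τ≈f | nothing = τ , agrees
    where
    agrees : ∀ a b → a ∈ c ∷ D → f a ≡ just b → τ ⟨$⟩ʳ a ≡ b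
    agrees a b (here refl) fa with () ← trans (sym fc) fa
    agrees a b (there a∈D) fa = τ≈f a b a∈D fa
  ... | τ , τ≈f | just b₀ = τ ∘ₚ transpose (τ ⟨$⟩ʳ c) b₀ , agrees
    where
    agrees : ∀ a b → a ∈ c ∷ D → f a ≡ just b →
             Transposition.transpose (τ ⟨$⟩ʳ c) b₀ (τ ⟨$⟩ʳ a) ≡ b
    agrees a b a∈cD fa with a ≟ c | a∈cD
    ... | yes refl | _ = trans (transpose-source (τ ⟨$⟩ʳ c) b₀) (just-injective (trans (sym fc) fa))
    ... | no a≢c | here a≡c = ⊥-elim (a≢c a≡c)
    ... | no a≢c | there a∈D rewrite τ≈f a b a∈D fa =
      transpose-other (τ ⟨$⟩ʳ c) b₀ b
        (λ b≡τc → a≢c (perm-injective τ (trans (τ≈f a b a∈D fa) b≡τc)))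
        (λ b≡b₀ → a≢c (inj a c b fa (trans fc (cong just (sym b≡b₀)))))

  extendToPermutation : (f : PartialFn k) → InjectivePartial f →
                        Σ (Permutation′ k) λ τ → ∀ a b → f a ≡ just b → τ ⟨$⟩ʳ a ≡ b
  extendToPermutation f inj with extendOn f inj (allFin k)
  ... | τ , τ≈f = τ , λ a b → τ≈f a b (∈-allFin a)

  conjugate : Permutation′ k → Permutation′ k → PartialFn k → PartialFn k
  conjugate α β f c = Maybe.map (β ⟨$⟩ʳ_) (f (α ⟨$⟩ˡ c))

  conjugate-injective : ∀ {α β f} → InjectivePartial f → InjectivePartial (conjugate α β f)
  conjugate-injective {α} {β} {f} inj a b c fa≡c fb≡c
    with f (α ⟨$⟩ˡ a) in fa | f (α ⟨$⟩ˡ b) in fb | fa≡c | fb≡c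
  ... | just d₁ | just d₂ | βd₁≡c | βd₂≡c =
    perm-injective (flip α) (inj _ _ d₁ fa (trans fb (cong just d₂≡d₁)))
    where
    d₂≡d₁ : d₂ ≡ d₁
    d₂≡d₁ = perm-injective β (trans (just-injective βd₂≡c) (sym (just-injective βd₁≡c)))

  conjugate-recovers : ∀ α β f (c : Fin k) →
                       f c ≡ Maybe.map (β ⟨$⟩ˡ_) (conjugate α β f (α ⟨$⟩ʳ c))
  conjugate-recovers α β f c rewrite inverseˡ α {c} with f c
  ... | just d = cong just (sym (inverseˡ β))
  ... | nothing = refl

  Aligns : Permutation′ k → Permutation′ k → PartialFn k → Set
  Aligns α β f = ∀ a b → f a ≡ just b → α ⟨$⟩ʳ a ≡ β ⟨$⟩ʳ b

  aligns-postcompose : ∀ {α β f} (σ : Permutation′ k) → Aligns α β f → Aligns (α ∘ₚ σ) (β ∘ₚ σ) f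
  aligns-postcompose σ αβ a b fab = cong (σ ⟨$⟩ʳ_) (αβ a b fab)

  -- Any α and β can be made to align an injective f by post-composing β with a
  -- suitable σ: take σ⁻¹ extending the partial injection α⁻¹ ; f ; β.
  alignable : ∀ {f} → InjectivePartial f → (α β : Permutation′ k) →
              Σ (Permutation′ k) λ σ → Aligns α (β ∘ₚ σ) f
  alignable {f} inj α β with extendToPermutation (conjugate α β f) (conjugate-injective {α} {β} inj)
  ... | τ , τ≈conj = flip τ , aligned
    where
    aligned : Aligns α (β ∘ₚ flip τ) f
    aligned a b fab = trans (sym (inverseˡ τ)) (cong (τ ⟨$⟩ˡ_) (τ≈conj _ _ hits))
      where
      hits : conjugate α β f (α ⟨$⟩ʳ a) ≡ just (β ⟨$⟩ʳ b)
      hits rewrite inverseˡ α {a} | fab = refl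

  aligned⇒straight : ∀ {α β f} → Aligns α β f → ∀ c d → conjugate α β f c ≡ just d → c ≡ d
  aligned⇒straight {α} {β} {f} αβ c d fc≡d with f (α ⟨$⟩ˡ c) in fc | fc≡d
  ... | just e | βe≡d = trans (sym (inverseʳ α)) (trans (αβ _ e fc) (just-injective βe≡d))

-- Paths in a relation

module _ {V : Set} where

  data Path (R : V → V → Set) : V → V → List V → Set where
    end : ∀ u → Path R u u (u ∷ [])
    _▸_ : ∀ {u v w L} → R u v → Path R v w (v ∷ L) → Path R u w (u ∷ v ∷ L)

  infixr 5 _▸_

  path-map : ∀ {R R′ : V → V → Set} → (∀ {u v} → R u v → R′ u v) →
             ∀ {u w L} → Path R u w L → Path R′ u w L
  path-map f (end u) = end u
  path-map f (r ▸ p) = f r ▸ path-map f p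

  -- Two paths joined by one more step (the second path is split so that its
  -- vertex list visibly starts with b).
  path-join : ∀ {R : V → V → Set} {u a b w L₁ L₂} →
              Path R u a L₁ → R a b → Path R b w L₂ → Path R u w (L₁ ++ L₂)
  path-join (end u) r q@(end _) = r ▸ q
  path-join (end u) r q@(_ ▸ _) = r ▸ q
  path-join (r′ ▸ p) r q = r′ ▸ path-join p r q

  initial : ∀ {R : V → V → Set} {u w L} → Path R u w L → List V
  initial (end u) = []
  initial {u = u} (r ▸ p) = u ∷ initial p

  initial-++ : ∀ {R : V → V → Set} {u w L} (p : Path R u w L) → L ≡ initial p ++ [ w ]
  initial-++ (end u) = refl
  initial-++ {u = u} (r ▸ p) = cong (u ∷_) (initial-++ p)

  path-constant : ∀ {R : V → V → Set} {B : Set} (ℓ : V → B) → (∀ {u v} → R u v → ℓ u ≡ ℓ v) →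
                  ∀ {u w L} → Path R u w L → ∀ {z} → z ∈ L → ℓ z ≡ ℓ u
  path-constant ℓ const (end u) (here refl) = refl
  path-constant ℓ const (r ▸ p) (here refl) = refl
  path-constant ℓ const (r ▸ p) (there z∈L) = trans (path-constant ℓ const p z∈L) (sym (const r))

path-consecutive : ∀ {n} {R : Fin n → Fin n → Set} {u w L} → Path R u w L → Consecutive R L
path-consecutive (end u) = tt
path-consecutive (r ▸ p) = r , path-consecutive p

unique-rotate : ∀ {A : Set} (L : List A) {x} → Unique (L ++ [ x ]) → Unique (x ∷ L)
unique-rotate {A} L {x} = ↭.Unique-resp-↭ (setoid A) (↭.++-comm (setoid A) L [ x ])

-- Transport of colours along aligned full walks

module Transport {n k : ℕ} (G : OrientedGraph n) (C : Assignment n k) where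

  AlignedArc : (Fin n → Permutation′ k) → Fin n → Fin n → Set
  AlignedArc π u v = arc G u v ≡ true × Aligns (π u) (π v) (C u v)

  AlignedEdge : (Fin n → Permutation′ k) → Fin n → Fin n → Set
  AlignedEdge π u v = AlignedArc π u v ⊎ AlignedArc π v u

  transport-edge : ∀ {π u v} → AlignedEdge π u v → FullEdge G C u v →
                   ∀ c → ∃ λ d → Step G C u v c d × π u ⟨$⟩ʳ c ≡ π v ⟨$⟩ʳ d
  transport-edge (inj₁ (uv , aligned)) (full , _) c with full uv c
  ... | d , cd = d , inj₁ (uv , cd) , aligned c d cd
  transport-edge {π} {u} {v} (inj₂ (vu , aligned)) (_ , full) c =
    d , inj₂ (vu , subst (λ e → C v u d ≡ just e) (sym c≡c′) dc′) , sym (inverseʳ (π v))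
    where
    d : Fin k
    d = π v ⟨$⟩ˡ (π u ⟨$⟩ʳ c)
    c′ : Fin k
    c′ = proj₁ (full vu d)
    dc′ : C v u d ≡ just c′
    dc′ = proj₂ (full vu d)
    c≡c′ : c ≡ c′
    c≡c′ = perm-injective (π u) (trans (sym (inverseʳ (π v))) (aligned d c′ dc′))

  transport-walk : ∀ {π u w L} → Path (AlignedEdge π) u w L → Consecutive (FullEdge G C) L →
                   ∀ c → ∃ λ d → WalkRel G C L c d × π u ⟨$⟩ʳ c ≡ π w ⟨$⟩ʳ d
  transport-walk (end u) _ c = c , refl , refl
  transport-walk {π} (e ▸ p) (full , fulls) c with transport-edge {π} e full c
  ... | d , step , πc≡πd with transport-walk {π} p fulls d
  ...   | d′ , walk , πd≡πd′ = d′ , (d , step , walk) , trans πc≡πd πd≡πd′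

module _ {n : ℕ} {A : Set} (label : Fin n → Fin n) (y : Fin n) (inside outside : Fin n → A) where

  onClass : Fin n → A
  onClass w with label w ≟ label y
  ... | yes _ = inside w
  ... | no _ = outside w

  onClass-in : ∀ {w} → label w ≡ label y → onClass w ≡ inside w
  onClass-in {w} w∼y with label w ≟ label y
  ... | yes _ = refl
  ... | no w≁y = ⊥-elim (w≁y w∼y)

  onClass-out : ∀ {w} → label w ≢ label y → onClass w ≡ outside w
  onClass-out {w} w≁y with label w ≟ label y
  ... | yes w∼y = ⊥-elim (w≁y w∼y)
  ... | no _ = refl

  onClass-related : (P : A → A → Set) → ∀ {u v} → label u ≡ label v →
                    P (inside u) (inside v) → P (outside u) (outside v) → P (onClass u) (onClass v)
  onClass-related P {u} {v} u∼v P-in P-out with label u ≟ label y | label v ≟ label y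
  ... | yes _ | yes _ = P-in
  ... | no _ | no _ = P-out
  ... | yes u∼y | no v≁y = ⊥-elim (v≁y (trans (sym u∼v) u∼y))
  ... | no u≁y | yes v∼y = ⊥-elim (u≁y (trans u∼v v∼y))

module Straightening {n k : ℕ} (G : OrientedGraph n) (C : Assignment n k)
  (C-injective : IsCorrespondenceAssignment G k C) (H : Subgraph G)
  (cycles : ∀ (K : List (Fin n)) → IsCycleIn H K
            → ConsistentOn G C (closedWalk K) × Consecutive (FullEdge G C) (closedWalk K)) where

  open Transport G C

  Pair : Set
  Pair = Fin n × Fin n

  Perms : Set
  Perms = Fin n → Permutation′ k

  InS : List Pair → Fin n → Fin n → Set
  InS S u v = (u , v) ∈ S × inE H u v ≡ true

  Adj : List Pair → Fin n → Fin n → Set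
  Adj S u v = InS S u v ⊎ InS S v u

  AlignsAll : List Pair → Perms → Set
  AlignsAll S π = ∀ u v → InS S u v → Aligns (π u) (π v) (C u v)

  arc-of : ∀ {u v} → inE H u v ≡ true → arc G u v ≡ true
  arc-of {u} {v} uv∈H = proj₁ (inE⊆ H u v uv∈H)

  adj-extend : ∀ {S e u v} → Adj S u v → Adj (e ∷ S) u v
  adj-extend (inj₁ (uv∈S , uv∈H)) = inj₁ (there uv∈S , uv∈H)
  adj-extend (inj₂ (vu∈S , vu∈H)) = inj₂ (there vu∈S , vu∈H)

  adj-inH : ∀ {S u v} → Adj S u v → AdjIn H u v
  adj-inH = Sum.map proj₂ proj₂

  adj-inV : ∀ {S u v} → Adj S u v → inV H u ≡ true
  adj-inV {u = u} {v} (inj₁ (_ , uv∈H)) = proj₁ (proj₂ (inE⊆ H u v uv∈H))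
  adj-inV {u = u} {v} (inj₂ (_ , vu∈H)) = proj₂ (proj₂ (inE⊆ H v u vu∈H))

  adj-aligned : ∀ {S π} → AlignsAll S π → ∀ {u v} → Adj S u v → AlignedEdge π u v
  adj-aligned aligned {u} {v} (inj₁ uv@(_ , uv∈H)) = inj₁ (arc-of uv∈H , aligned u v uv)
  adj-aligned aligned {u} {v} (inj₂ vu@(_ , vu∈H)) = inj₂ (arc-of vu∈H , aligned v u vu)

  closing-cycle : ∀ {S x y v w L} → inE H x y ≡ true →
                  Path (Adj S) y x (y ∷ v ∷ w ∷ L) → Unique (y ∷ v ∷ w ∷ L) →
                  Σ (List (Fin n)) λ K → IsCycleIn H K × closedWalk K ≡ x ∷ y ∷ v ∷ w ∷ L
  closing-cycle {x = x} {y} {v} xy∈H p@(_ ▸ _ ▸ q) unique =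
    x ∷ y ∷ v ∷ initial q
    , (s≤s (s≤s (s≤s z≤n)) , rotated
      , subst (Consecutive (AdjIn H)) (sym closes) (inj₁ xy∈H , path-consecutive (path-map adj-inH p)))
    , closes
    where
    closes : closedWalk (x ∷ y ∷ v ∷ initial q) ≡ x ∷ y ∷ v ∷ _
    closes = cong (λ t → x ∷ y ∷ v ∷ t) (sym (initial-++ q))
    rotated : Unique (x ∷ y ∷ v ∷ initial q)
    rotated = unique-rotate (y ∷ v ∷ initial q)
                (subst Unique (cong (λ t → y ∷ v ∷ t) (initial-++ q)) unique)

  -- If π aligns a simple path y ⋯ x of processed edges then it aligns the H-edge xy:
  -- colours transport along the (full) path, and consistency on the cycle closed
  -- by xy brings them back.  Paths with fewer than two steps are excluded since G
  -- has no loops or 2-cycles, or already contain xy.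
  cycle-aligned : ∀ {S π x y L} → AlignsAll S π → inE H x y ≡ true →
                  Path (Adj S) y x L → Unique L → Aligns (π x) (π y) (C x y)
  cycle-aligned {x = x} _ xy∈H (end _) _ =
    ⊥-elim (true≢false (trans (sym (arc-of xy∈H)) (irrefl G x)))
  cycle-aligned {x = x} {y} _ xy∈H (inj₁ (_ , yx∈H) ▸ end _) _ =
    ⊥-elim (true≢false (trans (sym (arc-of yx∈H)) (antisym G x y (arc-of xy∈H))))
  cycle-aligned aligned _ (inj₂ xy∈S ▸ end _) _ = aligned _ _ xy∈S
  cycle-aligned {π = π} {x} aligned xy∈H p@(_ ▸ _ ▸ _) unique a b xab
    with closing-cycle xy∈H p unique
  ... | K , isCycle , closes with cycles K isCycle
  ...   | consistent , fulls
    with transport-walk {π} (path-map (adj-aligned {π = π} aligned) p)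
                            (proj₂ (subst (Consecutive (FullEdge G C)) closes fulls)) b
  ...     | d , walk , πb≡πd = trans (cong (π x ⟨$⟩ʳ_) a≡d) (sym πb≡πd)
    where
    a≡d : a ≡ d
    a≡d = subst (ConsistentOn G C) closes consistent a d (b , inj₁ (arc-of xy∈H , xab) , walk)

  record Components (S : List Pair) (comp : Fin n → Fin n) : Set where
    field
      linked : ∀ u w → comp u ≡ comp w → Σ (List (Fin n)) λ L → Path (Adj S) u w L × Unique L
      respects : ∀ {u v} → Adj S u v → comp u ≡ comp v
  open Components

  components-start : Components [] (λ v → v)
  components-start = record
    { linked = λ { u .u refl → u ∷ [] , end u , [] ∷ [] }
    ; respects = λ { (inj₁ (() , _)) ; (inj₂ (() , _)) } }

  outside-alone : ∀ {S comp w y} → Components S comp →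
                  inV H w ≡ false → inV H y ≡ true → comp w ≢ comp y
  outside-alone {w = w} {y} K w∉H y∈H w∼y with linked K w y w∼y
  ... | _ , end _ , _ = true≢false (trans (sym y∈H) w∉H)
  ... | _ , e ▸ _ , _ = true≢false (trans (sym (adj-inV e)) w∉H)

  linked-extend : ∀ {S comp e} → Components S comp → ∀ u w → comp u ≡ comp w →
                  Σ (List (Fin n)) λ L → Path (Adj (e ∷ S)) u w L × Unique L
  linked-extend K u w u∼w with linked K u w u∼w
  ... | L , p , unique = L , path-map adj-extend p , unique

  components-keep : ∀ {S comp x y} → (inE H x y ≡ true → comp x ≡ comp y) →
                    Components S comp → Components ((x , y) ∷ S) comp
  components-keep {S} {comp} {x} {y} x∼y K = record { linked = linked-extend K ; respects = respects′ }
    where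
    respects′ : ∀ {u v} → Adj ((x , y) ∷ S) u v → comp u ≡ comp v
    respects′ (inj₁ (here refl , xy∈H)) = x∼y xy∈H
    respects′ (inj₂ (here refl , xy∈H)) = sym (x∼y xy∈H)
    respects′ (inj₁ (there uv∈S , uv∈H)) = respects K (inj₁ (uv∈S , uv∈H))
    respects′ (inj₂ (there vu∈S , vu∈H)) = respects K (inj₂ (vu∈S , vu∈H))

  merged : (Fin n → Fin n) → Fin n → Fin n → Fin n → Fin n
  merged comp x y = onClass comp y (λ _ → comp x) comp

  -- Processing an edge xy of H between two classes merges them: a new path runs
  -- through xy and is simple since its two halves lie in different classes.
  components-merge : ∀ {S comp x y} → inE H x y ≡ true → comp x ≢ comp y →
                     Components S comp → Components ((x , y) ∷ S) (merged comp x y)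
  components-merge {S} {comp} {x} {y} xy∈H x≁y K = record { linked = linked′ ; respects = respects′ }
    where
    S′ : List Pair
    S′ = (x , y) ∷ S
    comp′ : Fin n → Fin n
    comp′ = merged comp x y
    x↦x : comp′ x ≡ comp x
    x↦x = onClass-out comp y _ comp x≁y
    y↦x : comp′ y ≡ comp x
    y↦x = onClass-in comp y _ comp refl
    respects′ : ∀ {u v} → Adj S′ u v → comp′ u ≡ comp′ v
    respects′ (inj₁ (here refl , _)) = trans x↦x (sym y↦x)
    respects′ (inj₂ (here refl , _)) = trans y↦x (sym x↦x)
    respects′ (inj₁ (there uv∈S , uv∈H)) =
      onClass-related comp y _ comp _≡_ (respects K (inj₁ (uv∈S , uv∈H))) refl (respects K (inj₁ (uv∈S , uv∈H)))
    respects′ (inj₂ (there vu∈S , vu∈H)) =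
      onClass-related comp y _ comp _≡_ (respects K (inj₂ (vu∈S , vu∈H))) refl (respects K (inj₂ (vu∈S , vu∈H)))
    bridge : ∀ {u a b w} → comp u ≡ comp a → comp b ≡ comp w → comp a ≢ comp b → Adj S′ a b →
             Σ (List (Fin n)) λ L → Path (Adj S′) u w L × Unique L
    bridge {u} {a} {b} {w} u∼a b∼w a≁b ab with linked K u a u∼a | linked K b w b∼w
    ... | L₁ , p₁ , unique₁ | L₂ , p₂ , unique₂ =
      L₁ ++ L₂ , path-join (path-map adj-extend p₁) ab (path-map adj-extend p₂)
      , Unique.++⁺ unique₁ unique₂ λ { (z∈L₁ , z∈L₂) → a≁b (trans (sym u∼a)
          (trans (sym (path-constant comp (respects K) p₁ z∈L₁)) (path-constant comp (respects K) p₂ z∈L₂))) }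
    linked′ : ∀ u w → comp′ u ≡ comp′ w → Σ (List (Fin n)) λ L → Path (Adj S′) u w L × Unique L
    linked′ u w u∼′w = by-cases (comp u ≟ comp y) (comp w ≟ comp y)
      where
      by-cases : Dec (comp u ≡ comp y) → Dec (comp w ≡ comp y) →
                 Σ (List (Fin n)) λ L → Path (Adj S′) u w L × Unique L
      by-cases (yes u∼y) (yes w∼y) = linked-extend K u w (trans u∼y (sym w∼y))
      by-cases (no u≁y) (no w≁y) = linked-extend K u w
        (trans (sym (onClass-out comp y _ comp u≁y)) (trans u∼′w (onClass-out comp y _ comp w≁y)))
      by-cases (yes u∼y) (no w≁y) = bridge u∼y
        (trans (sym (onClass-in comp y _ comp u∼y)) (trans u∼′w (onClass-out comp y _ comp w≁y)))
        (λ y∼x → x≁y (sym y∼x)) (inj₂ (here refl , xy∈H))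
      by-cases (no u≁y) (yes w∼y) = bridge
        (trans (sym (onClass-out comp y _ comp u≁y)) (trans u∼′w (onClass-in comp y _ comp w∼y)))
        (sym w∼y) x≁y (inj₁ (here refl , xy∈H))

  record Invariant (S : List Pair) (π : Perms) (comp : Fin n → Fin n) : Set where
    field
      components : Components S comp
      aligned : AlignsAll S π
      fixed : ∀ v → inV H v ≡ false → Fixed π v

  invariant-start : Invariant [] (λ _ → idₚ) (λ v → v)
  invariant-start = record
    { components = components-start ; aligned = λ { _ _ (() , _) } ; fixed = λ _ _ _ → refl }

  -- A pair that is not an edge of H, or joins two vertices of one class, needs no
  -- change: in the latter case the new edge is aligned by the cycle it closes.
  invariant-keep : ∀ {S π comp x y} → Invariant S π comp → (inE H x y ≡ true → comp x ≡ comp y) →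
                   Invariant ((x , y) ∷ S) π comp
  invariant-keep {S} {π} {comp} {x} {y} I x∼y = record
    { components = components-keep x∼y components ; aligned = aligned′ ; fixed = fixed }
    where
    open Invariant I
    aligned′ : AlignsAll ((x , y) ∷ S) π
    aligned′ _ _ (here refl , xy∈H) with linked components y x (sym (x∼y xy∈H))
    ... | _ , p , unique = cycle-aligned {π = π} aligned xy∈H p unique
    aligned′ u v (there uv∈S , uv∈H) = aligned u v (uv∈S , uv∈H)

  -- An edge xy of H between two classes: post-composing the permutations on the
  -- class of y with σ, chosen to align xy, keeps all edges inside either class
  -- aligned and moves no vertex outside H.
  invariant-merge : ∀ {S π comp x y} → Invariant S π comp → inE H x y ≡ true → comp x ≢ comp y →
                    Σ Perms λ π′ → Invariant ((x , y) ∷ S) π′ (merged comp x y)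
  invariant-merge {S} {π} {comp} {x} {y} I xy∈H x≁y with alignable (C-injective x y (arc-of xy∈H)) (π x) (π y)
  ... | σ , σ-aligns = π′ , record
    { components = components-merge xy∈H x≁y components ; aligned = aligned′ ; fixed = fixed′ }
    where
    open Invariant I
    π′ : Perms
    π′ = onClass comp y (λ w → π w ∘ₚ σ) π
    aligned′ : AlignsAll ((x , y) ∷ S) π′
    aligned′ _ _ (here refl , _)
      rewrite onClass-out comp y (λ w → π w ∘ₚ σ) π x≁y | onClass-in comp y (λ w → π w ∘ₚ σ) π refl
      = σ-aligns
    aligned′ u v (there uv∈S , uv∈H) =
      onClass-related comp y _ π (λ α β → Aligns α β (C u v)) (respects components (inj₁ (uv∈S , uv∈H)))
        (aligns-postcompose {α = π u} {β = π v} σ (aligned u v (uv∈S , uv∈H))) (aligned u v (uv∈S , uv∈H))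
    fixed′ : ∀ v → inV H v ≡ false → Fixed π′ v
    fixed′ v v∉H
      rewrite onClass-out comp y (λ w → π w ∘ₚ σ) π
                (outside-alone components v∉H (proj₂ (proj₂ (inE⊆ H x y xy∈H))))
      = fixed v v∉H

  invariant-step : ∀ {S π comp} → Invariant S π comp → ∀ x y →
                   Σ Perms λ π′ → Σ (Fin n → Fin n) λ comp′ → Invariant ((x , y) ∷ S) π′ comp′
  invariant-step {π = π} {comp} I x y with comp x ≟ comp y | inE H x y in xy
  ... | yes x∼y | _ = π , comp , invariant-keep I (λ _ → x∼y)
  ... | no _ | false = π , comp , invariant-keep I (λ xy∈H → ⊥-elim (true≢false (trans (sym xy∈H) xy)))
  ... | no x≁y | true with invariant-merge I xy x≁y
  ...   | π′ , I′ = π′ , merged comp x y , I′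

  scan : (S : List Pair) → Σ Perms λ π → Σ (Fin n → Fin n) λ comp → Invariant S π comp
  scan [] = (λ _ → idₚ) , (λ v → v) , invariant-start
  scan ((x , y) ∷ S) with scan S
  ... | π , comp , I = invariant-step I x y

  alignment : Σ Perms λ π → (∀ u v → inE H u v ≡ true → Aligns (π u) (π v) (C u v))
                            × (∀ v → inV H v ≡ false → Fixed π v)
  alignment with scan (cartesianProduct (allFin n) (allFin n))
  ... | π , _ , I = π , (λ u v uv∈H → aligned u v (∈-cartesianProduct⁺ (∈-allFin u) (∈-allFin v) , uv∈H)) , fixed
    where open Invariant I

lemma4 : ∀ {n : ℕ} (k : ℕ) (G : OrientedGraph n) (C : Assignment n k)
         → IsCorrespondenceAssignment G k C
         → (H : Subgraph G)
         → (∀ (K : List (Fin n)) → IsCycleIn H K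
              → ConsistentOn G C (closedWalk K)
                × Consecutive (FullEdge G C) (closedWalk K))
         → Σ (Assignment n k) λ C' → Σ (Fin n → Permutation′ k) λ π →
             IsCorrespondenceAssignment G k C'
             × EquivalentVia G C C' π
             × (∀ (u v : Fin n) → inE H u v ≡ true → StraightArc C' u v)
             × (∀ (v : Fin n) → inV H v ≡ false → Fixed π v)
lemma4 k G C C-injective H cycles with Straightening.alignment G C C-injective H cycles
... | π , aligned , fixed =
  C′ , π
  , (λ u v uv → conjugate-injective {α = π u} {β = π v} (C-injective u v uv))
  , (λ u v _ → conjugate-recovers (π u) (π v) (C u v))
  , (λ u v uv∈H → aligned⇒straight {α = π u} {β = π v} (aligned u v uv∈H))
  , fixed
  where
  C′ : Assignment _ k
  C′ u v = conjugate (π u) (π v) (C u v)
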